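{- For all positive integers $n,k$ with $n\ge k$ and all $x\in\mathbb{C}$, $$\sum_{i=0}^{k}(-1)^i\, i!\binom{n}{i}\binom{k}{i}\prod_{j=0}^{n-1-i}(x+k+j)=\prod_{j=0}^{n-1}(x+j).$$
   Context: An empty product equals $1$. -}

module Defs where

open import Data.Nat using (ℕ; zero; suc)
open import Algebra.Bundles using (CommutativeRing)

module _ {c ℓ} (R : CommutativeRing c ℓ) where
  open CommutativeRing R

  ι : ℕ → Carrier
  ι zero    = 0#
  ι (suc n) = 1# + ι n

  sgn : ℕ → Carrier
  sgn zero    = 1#
  sgn (suc i) = - sgn i

  Σ< : ℕ → (ℕ → Carrier) → Carrier
  Σ< zero    f = 0#
  Σ< (suc m) f = Σ< m f + f m

  Π< : ℕ → (ℕ → Carrier) → Carrier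
  Π< zero    f = 1#
  Π< (suc m) f = Π< m f * f m

-- Writing a⁽ᵐ⁾ = a (a + 1) ⋯ (a + m - 1) for the rising factorial, the right-hand
-- side is x⁽ⁿ⁾ = (-k + (x + k))⁽ⁿ⁾. The Chu–Vandermonde identity for rising factorials,
-- (a + b)⁽ⁿ⁾ = Σᵢ C(n,i) a⁽ⁱ⁾ b⁽ⁿ⁻ⁱ⁾, expands it, and (-k)⁽ⁱ⁾ = (-1)ⁱ i! C(k,i) turns the
-- expansion into the left-hand side; the terms with i > k vanish. Both identities hold
-- in every commutative ring.
module Submission where

open import Defs
open import Level using (Level)
open import Data.Nat as ℕ using (ℕ; _≤_; _∸_; _!)
open import Data.Nat.Combinatorics using (_C_)
open import Algebra.Bundles using (CommutativeRing)

open import Data.Nat using (zero; suc; s≤s; _≤′_; ≤′-refl; ≤′-step)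
import Data.Nat.Properties as ℕₚ
open import Data.Nat.Combinatorics using (k>n⇒nCk≡0; nCk+nC[k+1]≡[n+1]C[k+1])
open import Relation.Binary.PropositionalEquality as ≡ using (_≡_)
import Algebra.Properties.CommutativeSemigroup as CommutativeSemigroupProperties
import Algebra.Properties.Ring as RingProperties
import Relation.Binary.Reasoning.Setoid as SetoidReasoning

!*C-pascal : ∀ k i →
  suc i ! ℕ.* (k C suc i) ℕ.+ suc i ℕ.* (i ! ℕ.* (k C i)) ≡ suc i ! ℕ.* (suc k C suc i)
!*C-pascal k i = begin
  suc i ! ℕ.* (k C suc i) ℕ.+ suc i ℕ.* (i ! ℕ.* (k C i))
    ≡⟨ ≡.cong (suc i ! ℕ.* (k C suc i) ℕ.+_) (ℕₚ.*-assoc (suc i) (i !) (k C i)) ⟨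
  suc i ! ℕ.* (k C suc i) ℕ.+ suc i ! ℕ.* (k C i)
    ≡⟨ ℕₚ.*-distribˡ-+ (suc i !) (k C suc i) (k C i) ⟨
  suc i ! ℕ.* (k C suc i ℕ.+ k C i)
    ≡⟨ ≡.cong (suc i ! ℕ.*_) (ℕₚ.+-comm (k C suc i) (k C i)) ⟩
  suc i ! ℕ.* (k C i ℕ.+ k C suc i)
    ≡⟨ ≡.cong (suc i ! ℕ.*_) (nCk+nC[k+1]≡[n+1]C[k+1] k i) ⟩
  suc i ! ℕ.* (suc k C suc i) ∎
  where open ≡.≡-Reasoning

module _ {c ℓ} (R : CommutativeRing c ℓ) where
  open CommutativeRing R
  open SetoidReasoning setoid
  open CommutativeSemigroupProperties *-commutativeSemigroup using (x∙yz≈y∙xz)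
  open CommutativeSemigroupProperties +-commutativeSemigroup
    using () renaming (interchange to +-interchange; x∙yz≈y∙xz to +-x∙yz≈y∙xz; xy∙z≈xz∙y to +-xy∙z≈xz∙y)
  open RingProperties ring using (-0#≈0#; -‿+-comm; -‿distribˡ-*; [y-z]x≈yx-zx)

  ι-+ : ∀ m n → ι R (m ℕ.+ n) ≈ ι R m + ι R n
  ι-+ zero    n = sym (+-identityˡ (ι R n))
  ι-+ (suc m) n = trans (+-congˡ (ι-+ m n)) (sym (+-assoc 1# (ι R m) (ι R n)))

  ι-* : ∀ m n → ι R (m ℕ.* n) ≈ ι R m * ι R n
  ι-* zero    n = sym (zeroˡ (ι R n))
  ι-* (suc m) n = begin
    ι R (n ℕ.+ m ℕ.* n)         ≈⟨ ι-+ n (m ℕ.* n) ⟩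
    ι R n + ι R (m ℕ.* n)       ≈⟨ +-cong (sym (*-identityˡ (ι R n))) (ι-* m n) ⟩
    1# * ι R n + ι R m * ι R n  ≈⟨ distribʳ (ι R n) 1# (ι R m) ⟨
    (1# + ι R m) * ι R n        ∎

  Σ<-cong : ∀ m {f g} → (∀ {i} → i ℕ.< m → f i ≈ g i) → Σ< R m f ≈ Σ< R m g
  Σ<-cong zero    f≈g = refl
  Σ<-cong (suc m) f≈g = +-cong (Σ<-cong m (λ i<m → f≈g (ℕₚ.m<n⇒m<1+n i<m))) (f≈g ℕₚ.≤-refl)

  Σ<-distrib-+ : ∀ m f g → Σ< R m (λ i → f i + g i) ≈ Σ< R m f + Σ< R m g
  Σ<-distrib-+ zero    f g = sym (+-identityˡ 0#)
  Σ<-distrib-+ (suc m) f g =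
    trans (+-congʳ (Σ<-distrib-+ m f g)) (+-interchange (Σ< R m f) (Σ< R m g) (f m) (g m))

  *-distribˡ-Σ< : ∀ m a f → a * Σ< R m f ≈ Σ< R m (λ i → a * f i)
  *-distribˡ-Σ< zero    a f = zeroʳ a
  *-distribˡ-Σ< (suc m) a f = trans (distribˡ a (Σ< R m f) (f m)) (+-congʳ (*-distribˡ-Σ< m a f))

  Σ<-suc : ∀ m f → Σ< R (suc m) f ≈ f 0 + Σ< R m (λ i → f (suc i))
  Σ<-suc zero    f = trans (+-identityˡ (f 0)) (sym (+-identityʳ (f 0)))
  Σ<-suc (suc m) f = trans (+-congʳ (Σ<-suc m f)) (+-assoc (f 0) _ (f (suc m)))

  Σ<-vanishing-tail : ∀ {m n f} → m ≤ n → (∀ {i} → m ≤ i → f i ≈ 0#) → Σ< R n f ≈ Σ< R m f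
  Σ<-vanishing-tail {m} {f = f} m≤n f≈0 = go (ℕₚ.≤⇒≤′ m≤n)
    where
    go : ∀ {n} → m ≤′ n → Σ< R n f ≈ Σ< R m f
    go ≤′-refl          = refl
    go (≤′-step m≤′n) =
      trans (+-cong (go m≤′n) (f≈0 (ℕₚ.≤′⇒≤ m≤′n))) (+-identityʳ (Σ< R m f))

  Π<-cong : ∀ m {f g} → (∀ i → f i ≈ g i) → Π< R m f ≈ Π< R m g
  Π<-cong zero    f≈g = refl
  Π<-cong (suc m) f≈g = *-cong (Π<-cong m f≈g) (f≈g m)

  Π<-suc : ∀ m f → Π< R (suc m) f ≈ f 0 * Π< R m (λ i → f (suc i))
  Π<-suc zero    f = trans (*-identityˡ (f 0)) (sym (*-identityʳ (f 0)))
  Π<-suc (suc m) f = trans (*-congʳ (Π<-suc m f)) (*-assoc (f 0) _ (f (suc m)))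

  rising : Carrier → ℕ → Carrier
  rising a m = Π< R m (λ j → a + ι R j)

  rising-cong : ∀ m {a b} → a ≈ b → rising a m ≈ rising b m
  rising-cong m a≈b = Π<-cong m (λ j → +-congʳ a≈b)

  rising-suc : ∀ a m → rising a (suc m) ≈ a * rising (a + 1#) m
  rising-suc a m =
    trans (Π<-suc m _) (*-cong (+-identityʳ a) (Π<-cong m (λ j → sym (+-assoc a 1# (ι R j)))))

  rising-shift : ∀ a k m → rising (a + ι R k) m ≈ Π< R m (λ j → a + ι R (k ℕ.+ j))
  rising-shift a k m = Π<-cong m (λ j → trans (+-assoc a (ι R k) (ι R j)) (+-congˡ (sym (ι-+ k j))))

  rising-pred : ∀ a i → rising (a - 1#) (suc i) ≈ rising a (suc i) - ι R (suc i) * rising a i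
  rising-pred a i = begin
    rising (a - 1#) (suc i)                  ≈⟨ rising-suc (a - 1#) i ⟩
    (a - 1#) * rising (a - 1# + 1#) i        ≈⟨ *-congˡ (rising-cong i a-1+1≈a) ⟩
    (a - 1#) * rising a i                    ≈⟨ *-congʳ a+p-[1+p]≈a-1 ⟨
    ((a + p) - (1# + p)) * rising a i        ≈⟨ [y-z]x≈yx-zx (rising a i) (a + p) (1# + p) ⟩
    (a + p) * rising a i - (1# + p) * rising a i
                                             ≈⟨ +-congʳ (*-comm (a + p) (rising a i)) ⟩
    rising a i * (a + p) - (1# + p) * rising a i ∎
    where
    p = ι R i
    a-1+1≈a : a - 1# + 1# ≈ a
    a-1+1≈a = trans (+-assoc a (- 1#) 1#) (trans (+-congˡ (-‿inverseˡ 1#)) (+-identityʳ a))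
    a+p-[1+p]≈a-1 : (a + p) - (1# + p) ≈ a - 1#
    a+p-[1+p]≈a-1 = begin
      (a + p) - (1# + p)       ≈⟨ +-congˡ (-‿+-comm 1# p) ⟨
      (a + p) + (- 1# + - p)   ≈⟨ +-interchange a p (- 1#) (- p) ⟩
      (a - 1#) + (p - p)       ≈⟨ +-congˡ (-‿inverseʳ p) ⟩
      (a - 1#) + 0#            ≈⟨ +-identityʳ (a - 1#) ⟩
      a - 1#                   ∎

  rising-neg : ∀ k i → rising (- ι R k) i ≈ sgn R i * ι R (i ! ℕ.* (k C i))
  rising-neg k       zero    = sym (trans (*-identityˡ (1# + 0#)) (+-identityʳ 1#))
  rising-neg zero    (suc i) = begin
    rising (- 0#) (suc i)             ≈⟨ rising-suc (- 0#) i ⟩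
    - 0# * rising (- 0# + 1#) i       ≈⟨ trans (*-congʳ -0#≈0#) (zeroˡ _) ⟩
    0#                                ≈⟨ zeroʳ (sgn R (suc i)) ⟨
    sgn R (suc i) * ι R 0             ≡⟨ ≡.cong (λ m → sgn R (suc i) * ι R m) (ℕₚ.*-zeroʳ (suc i !)) ⟨
    sgn R (suc i) * ι R (suc i ! ℕ.* (0 C suc i)) ∎
  rising-neg (suc k) (suc i) = begin
    rising (- (1# + ι R k)) (suc i)              ≈⟨ rising-cong (suc i) -[1+ιk]≈-ιk-1 ⟩
    rising (- ι R k - 1#) (suc i)                ≈⟨ rising-pred (- ι R k) i ⟩
    rising (- ι R k) (suc i) - p * rising (- ι R k) i
      ≈⟨ +-cong (rising-neg k (suc i)) (-‿cong (*-congˡ (rising-neg k i))) ⟩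
    - s * ι R A - p * (s * ι R B)                ≈⟨ +-congˡ -[p*[s*ιB]]≈-s*ι[[1+i]*B] ⟩
    - s * ι R A + - s * ι R (suc i ℕ.* B)        ≈⟨ distribˡ (- s) (ι R A) _ ⟨
    - s * (ι R A + ι R (suc i ℕ.* B))            ≈⟨ *-congˡ (ι-+ A (suc i ℕ.* B)) ⟨
    - s * ι R (A ℕ.+ suc i ℕ.* B)                ≡⟨ ≡.cong (λ m → - s * ι R m) (!*C-pascal k i) ⟩
    - s * ι R (suc i ! ℕ.* (suc k C suc i))      ∎
    where
    s = sgn R i
    p = ι R (suc i)
    A = suc i ! ℕ.* (k C suc i)
    B = i ! ℕ.* (k C i)
    -[1+ιk]≈-ιk-1 : - (1# + ι R k) ≈ - ι R k - 1#
    -[1+ιk]≈-ιk-1 = trans (sym (-‿+-comm 1# (ι R k))) (+-comm (- 1#) (- ι R k))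
    -[p*[s*ιB]]≈-s*ι[[1+i]*B] : - (p * (s * ι R B)) ≈ - s * ι R (suc i ℕ.* B)
    -[p*[s*ιB]]≈-s*ι[[1+i]*B] = begin
      - (p * (s * ι R B))     ≈⟨ -‿cong (x∙yz≈y∙xz p s (ι R B)) ⟩
      - (s * (p * ι R B))     ≈⟨ -‿distribˡ-* s (p * ι R B) ⟩
      - s * (p * ι R B)       ≈⟨ *-congˡ (ι-* (suc i) B) ⟨
      - s * ι R (suc i ℕ.* B) ∎

  Σ<-pascal : ∀ n (u : ℕ → Carrier) →
    Σ< R (suc (suc n)) (λ i → ι R (suc n C i) * u i)
      ≈ Σ< R (suc n) (λ i → ι R (n C i) * u (suc i)) + Σ< R (suc n) (λ i → ι R (n C i) * u i)
  Σ<-pascal n u = begin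
    Σ< R (suc (suc n)) (λ i → ι R (suc n C i) * u i)
      ≈⟨ Σ<-suc (suc n) _ ⟩
    u₀ + Σ< R (suc n) (λ i → ι R (suc n C suc i) * u (suc i))
      ≈⟨ +-congˡ (Σ<-cong (suc n) (λ {i} _ → split i)) ⟩
    u₀ + Σ< R (suc n) (λ i → ι R (n C i) * u (suc i) + ι R (n C suc i) * u (suc i))
      ≈⟨ +-congˡ (Σ<-distrib-+ (suc n) _ _) ⟩
    u₀ + (S + Σ< R (suc n) (λ i → ι R (n C suc i) * u (suc i)))
      ≈⟨ +-x∙yz≈y∙xz u₀ S _ ⟩
    S + (u₀ + Σ< R (suc n) (λ i → ι R (n C suc i) * u (suc i)))
      ≈⟨ +-congˡ (+-congˡ (Σ<-vanishing-tail (ℕₚ.n≤1+n n) vanish)) ⟩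
    S + (u₀ + Σ< R n (λ i → ι R (n C suc i) * u (suc i)))
      ≈⟨ +-congˡ (Σ<-suc n _) ⟨
    S + Σ< R (suc n) (λ i → ι R (n C i) * u i) ∎
    where
    u₀ = ι R (n C 0) * u 0
    S = Σ< R (suc n) (λ i → ι R (n C i) * u (suc i))
    split : ∀ i → ι R (suc n C suc i) * u (suc i) ≈ ι R (n C i) * u (suc i) + ι R (n C suc i) * u (suc i)
    split i = begin
      ι R (suc n C suc i) * u (suc i)
        ≡⟨ ≡.cong (λ m → ι R m * u (suc i)) (nCk+nC[k+1]≡[n+1]C[k+1] n i) ⟨
      ι R (n C i ℕ.+ n C suc i) * u (suc i)
        ≈⟨ *-congʳ (ι-+ (n C i) (n C suc i)) ⟩
      (ι R (n C i) + ι R (n C suc i)) * u (suc i)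
        ≈⟨ distribʳ (u (suc i)) (ι R (n C i)) (ι R (n C suc i)) ⟩
      ι R (n C i) * u (suc i) + ι R (n C suc i) * u (suc i) ∎
    vanish : ∀ {i} → n ≤ i → ι R (n C suc i) * u (suc i) ≈ 0#
    vanish n≤i = trans (*-congʳ (reflexive (≡.cong (ι R) (k>n⇒nCk≡0 (s≤s n≤i))))) (zeroˡ (u _))

  rising-vandermonde : ∀ n a b →
    rising (a + b) n ≈ Σ< R (suc n) (λ i → ι R (n C i) * (rising a i * rising b (n ∸ i)))
  rising-vandermonde zero    a b =
    sym (trans (+-identityˡ _) (trans (*-congʳ (+-identityʳ 1#)) (trans (*-identityˡ _) (*-identityˡ 1#))))
  rising-vandermonde (suc n) a b = begin
    rising (a + b) (suc n)
      ≈⟨ rising-suc (a + b) n ⟩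
    (a + b) * rising (a + b + 1#) n
      ≈⟨ distribʳ _ a b ⟩
    a * rising (a + b + 1#) n + b * rising (a + b + 1#) n
      ≈⟨ +-cong (*-congˡ (rising-cong n (+-xy∙z≈xz∙y a b 1#)))
                (*-congˡ (rising-cong n (+-assoc a b 1#))) ⟩
    a * rising ((a + 1#) + b) n + b * rising (a + (b + 1#)) n
      ≈⟨ +-cong (*-congˡ (rising-vandermonde n (a + 1#) b))
                (*-congˡ (rising-vandermonde n a (b + 1#))) ⟩
    a * Σ< R (suc n) (λ i → ι R (n C i) * (rising (a + 1#) i * rising b (n ∸ i)))
      + b * Σ< R (suc n) (λ i → ι R (n C i) * (rising a i * rising (b + 1#) (n ∸ i)))
      ≈⟨ +-cong (trans (*-distribˡ-Σ< (suc n) a _) (Σ<-cong (suc n) (λ {i} _ → absorb-a i)))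
                (trans (*-distribˡ-Σ< (suc n) b _) (Σ<-cong (suc n) absorb-b)) ⟩
    Σ< R (suc n) (λ i → ι R (n C i) * u (suc i)) + Σ< R (suc n) (λ i → ι R (n C i) * u i)
      ≈⟨ Σ<-pascal n u ⟨
    Σ< R (suc (suc n)) (λ i → ι R (suc n C i) * u i) ∎
    where
    u : ℕ → Carrier
    u i = rising a i * rising b (suc n ∸ i)
    absorb-a : ∀ i → a * (ι R (n C i) * (rising (a + 1#) i * rising b (n ∸ i))) ≈ ι R (n C i) * u (suc i)
    absorb-a i = begin
      a * (ι R (n C i) * (rising (a + 1#) i * rising b (n ∸ i)))
        ≈⟨ x∙yz≈y∙xz a _ _ ⟩
      ι R (n C i) * (a * (rising (a + 1#) i * rising b (n ∸ i)))
        ≈⟨ *-congˡ (*-assoc a _ _) ⟨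
      ι R (n C i) * (a * rising (a + 1#) i * rising b (n ∸ i))
        ≈⟨ *-congˡ (*-congʳ (rising-suc a i)) ⟨
      ι R (n C i) * u (suc i) ∎
    absorb-b : ∀ {i} → i ℕ.< suc n → b * (ι R (n C i) * (rising a i * rising (b + 1#) (n ∸ i))) ≈ ι R (n C i) * u i
    absorb-b {i} (s≤s i≤n) = begin
      b * (ι R (n C i) * (rising a i * rising (b + 1#) (n ∸ i)))
        ≈⟨ x∙yz≈y∙xz b _ _ ⟩
      ι R (n C i) * (b * (rising a i * rising (b + 1#) (n ∸ i)))
        ≈⟨ *-congˡ (x∙yz≈y∙xz b _ _) ⟩
      ι R (n C i) * (rising a i * (b * rising (b + 1#) (n ∸ i)))
        ≈⟨ *-congˡ (*-congˡ (rising-suc b (n ∸ i))) ⟨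
      ι R (n C i) * (rising a i * rising b (suc (n ∸ i)))
        ≡⟨ ≡.cong (λ m → ι R (n C i) * (rising a i * rising b m)) (ℕₚ.+-∸-assoc 1 i≤n) ⟨
      ι R (n C i) * u i ∎

  sgn*ι[!*C*C]≈ι[C]*rising-neg : ∀ n k i y →
    sgn R i * ι R (i ! ℕ.* (n C i) ℕ.* (k C i)) * y ≈ ι R (n C i) * (rising (- ι R k) i * y)
  sgn*ι[!*C*C]≈ι[C]*rising-neg n k i y = begin
    sgn R i * ι R (i ! ℕ.* (n C i) ℕ.* (k C i)) * y
      ≡⟨ ≡.cong (λ m → sgn R i * ι R m * y) !*C*C≡C*[!*C] ⟩
    sgn R i * ι R ((n C i) ℕ.* B) * y          ≈⟨ *-congʳ (*-congˡ (ι-* (n C i) B)) ⟩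
    sgn R i * (ι R (n C i) * ι R B) * y        ≈⟨ *-congʳ (x∙yz≈y∙xz (sgn R i) _ _) ⟩
    ι R (n C i) * (sgn R i * ι R B) * y        ≈⟨ *-assoc _ _ y ⟩
    ι R (n C i) * (sgn R i * ι R B * y)        ≈⟨ *-congˡ (*-congʳ (rising-neg k i)) ⟨
    ι R (n C i) * (rising (- ι R k) i * y)     ∎
    where
    B = i ! ℕ.* (k C i)
    !*C*C≡C*[!*C] : i ! ℕ.* (n C i) ℕ.* (k C i) ≡ (n C i) ℕ.* B
    !*C*C≡C*[!*C] =
      ≡.trans (≡.cong (ℕ._* (k C i)) (ℕₚ.*-comm (i !) (n C i))) (ℕₚ.*-assoc (n C i) (i !) (k C i))

  -a+[x+a]≈x : ∀ a x → - a + (x + a) ≈ x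
  -a+[x+a]≈x a x = trans (+-x∙yz≈y∙xz (- a) x a) (trans (+-congˡ (-‿inverseˡ a)) (+-identityʳ x))

-- The identity also holds for k = 0.
lemma3p3p4 : {c ℓ : Level} (R : CommutativeRing c ℓ) →
    let open CommutativeRing R in
    (n k : ℕ) → 1 ≤ k → k ≤ n → (x : Carrier) →
    Σ< R (ℕ.suc k)
      (λ i → sgn R i * ι R ((i !) ℕ.* (n C i) ℕ.* (k C i))
               * Π< R (n ∸ i) (λ j → x + ι R (k ℕ.+ j)))
    ≈ Π< R n (λ j → x + ι R j)
lemma3p3p4 R n k _ k≤n x = begin
  Σ< R (suc k) term          ≈⟨ Σ<-vanishing-tail R (s≤s k≤n) term-vanishes ⟨
  Σ< R (suc n) term          ≈⟨ Σ<-cong R (suc n) (λ {i} _ → term≈ i) ⟩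
  Σ< R (suc n) (λ i → ι R (n C i) * (rising R (- ι R k) i * rising R (x + ι R k) (n ∸ i)))
                             ≈⟨ rising-vandermonde R n (- ι R k) (x + ι R k) ⟨
  rising R (- ι R k + (x + ι R k)) n
                             ≈⟨ rising-cong R n (-a+[x+a]≈x R (ι R k) x) ⟩
  rising R x n               ∎
  where
  open CommutativeRing R
  open SetoidReasoning setoid

  tail : ℕ → Carrier
  tail i = Π< R (n ∸ i) (λ j → x + ι R (k ℕ.+ j))

  term : ℕ → Carrier
  term i = sgn R i * ι R ((i !) ℕ.* (n C i) ℕ.* (k C i)) * tail i

  term-vanishes : ∀ {i} → suc k ≤ i → term i ≈ 0#
  term-vanishes {i} k<i = begin
    term i                 ≡⟨ ≡.cong (λ m → sgn R i * ι R m * tail i) !*C*C≡0 ⟩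
    sgn R i * 0# * tail i  ≈⟨ trans (*-congʳ (zeroʳ (sgn R i))) (zeroˡ (tail i)) ⟩
    0#                     ∎
    where
    !*C*C≡0 : (i !) ℕ.* (n C i) ℕ.* (k C i) ≡ 0
    !*C*C≡0 = ≡.trans (≡.cong ((i !) ℕ.* (n C i) ℕ.*_) (k>n⇒nCk≡0 k<i)) (ℕₚ.*-zeroʳ ((i !) ℕ.* (n C i)))

  term≈ : ∀ i → term i ≈ ι R (n C i) * (rising R (- ι R k) i * rising R (x + ι R k) (n ∸ i))
  term≈ i = trans (sgn*ι[!*C*C]≈ι[C]*rising-neg R n k i (tail i))
                  (*-congˡ (*-congˡ (sym (rising-shift R x k (n ∸ i)))))
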